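{- Let $A$ be an $n\times n$ matrix over a field $\mathbb{F}$ with all off-diagonal entries nonzero. Let $S$ be a minimal cut of $A$ with $|S|>2$. Let $T$ be a nonempty subset of $\overline S$, $X\subseteq S\cup T$, and $\widetilde X=(S\cup T)\setminus X$. If $X$ is a cut of $A[S\cup T]$, then $S\subseteq X$ or $S\subseteq\widetilde X$. In particular, for every $t\in\overline S$, the matrix $A[S\cup\{t\}]$ has no cut.
   Context: $\overline S=[n]\setminus S$; for index sets $P,Q$, $A[P,Q]$ is the submatrix with rows $P$ and columns $Q$, $A[P]=A[P,P]$. For a matrix $M$ with rows and columns indexed by a set $I$ with $|I|\ge4$, a set $X\subset I$ is a cut of $M$ if $2\le|X|\le|I|-2$ and $M[X,I\setminus X]$, $M[I\setminus X,X]$ both have rank at most one (a matrix indexed by fewer than 4 elements has no cut). A cut $S$ of $A$ is minimal if no other cut of $A$ is a subset of $S$. -}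

module Defs where

open import Level using (Level; _⊔_; suc)
open import Algebra.Bundles using (CommutativeRing)
open import Data.Nat using (ℕ; _≤_; _+_)
open import Data.Fin using (Fin)
open import Data.Fin.Subset using (Subset; _∈_; _⊆_; ∁; _∩_; ∣_∣)
open import Data.Product using (Σ; ∃; _×_)
open import Relation.Nullary using (¬_)

record Field (c ℓ : Level) : Set (Level.suc (c ⊔ ℓ)) where
  field
    commutativeRing : CommutativeRing c ℓ
  open CommutativeRing commutativeRing public
  field
    1≉0     : ¬ (1# ≈ 0#)
    inverse : ∀ x → ¬ (x ≈ 0#) → ∃ λ y → (x * y) ≈ 1#

module _ {c ℓ : Level} (F : Field c ℓ) where
  open Field F using (Carrier; _≈_; _*_; 0#)

  Matrix : ℕ → Set c
  Matrix n = Fin n → Fin n → Carrier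

  OffDiagNonzero : ∀ {n} → Matrix n → Set ℓ
  OffDiagNonzero {n} A = ∀ (i j : Fin n) → ¬ (i ≡ j) → ¬ (A i j ≈ 0#)
    where open import Relation.Binary.PropositionalEquality using (_≡_)

  -- The submatrix A[P,Q] has rank at most one: its column space is spanned
  -- by a single vector u, i.e. every column (j ∈ Q) is a scalar multiple of
  -- u restricted to the rows in P.
  RankAtMostOne : ∀ {n} → Matrix n → Subset n → Subset n → Set (c ⊔ ℓ)
  RankAtMostOne {n} A P Q =
    ∃ λ (u : Fin n → Carrier) →
      ∀ j → j ∈ Q → ∃ λ (a : Carrier) → ∀ i → i ∈ P → A i j ≈ (a * u i)

  -- X is a cut of the principal submatrix A[I] (rows/columns indexed by I):
  -- X ⊆ I, 2 ≤ |X| ≤ |I| - 2, and A[X, I∖X], A[I∖X, X] have rank ≤ 1.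
  -- (The requirement |I| ≥ 4 follows from 2 ≤ |X| ≤ |I| - 2.)
  IsCutOf : ∀ {n} → Matrix n → Subset n → Subset n → Set (c ⊔ ℓ)
  IsCutOf A I X =
    X ⊆ I × 2 ≤ ∣ X ∣ × ∣ X ∣ + 2 ≤ ∣ I ∣ ×
    RankAtMostOne A X (I ∩ ∁ X) × RankAtMostOne A (I ∩ ∁ X) X

  IsCut : ∀ {n} → Matrix n → Subset n → Set (c ⊔ ℓ)
  IsCut A X = IsCutOf A Data.Fin.Subset.⊤ X

  IsMinimalCut : ∀ {n} → Matrix n → Subset n → Set (c ⊔ ℓ)
  IsMinimalCut {n} A S =
    IsCut A S × (∀ (X : Subset n) → IsCut A X → X ⊆ S → X ≡ S)
    where open import Relation.Binary.PropositionalEquality using (_≡_)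

-- Suppose a cut X of A[S ∪ T] separates S, and let P be the part of S on a
-- side of X containing at least two points of S.  If the other side contains a
-- point t ∉ S, every column of A[P, ∁P] is a multiple of column t (through the
-- cut X for columns in S, through the cut S for columns outside S), and
-- likewise for rows; so P is a cut of A properly inside S, against minimality.
-- Since T ≠ ∅ and |S| ≥ 3, one of the two sides always admits such a t.
module Submission where

open import Defs
open import Level using (Level; _⊔_)
open import Data.Nat using (ℕ; _<_; _≤_; _+_; _≤?_; s≤s; z≤n)
import Data.Nat.Properties as ℕ
open import Data.Fin using (Fin)
open import Data.Fin.Subset using (Subset; _∈_; _∉_; _⊆_; _⊂_; ∁; _∩_; _∪_; ∣_∣; Nonempty; Empty; ⁅_⁆; ⊤; inside; outside)
open import Data.Fin.Subset.Properties
open import Data.Product using (_×_; _,_; proj₁; proj₂; ∃)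
open import Data.Sum using (_⊎_; inj₁; inj₂)
import Data.Sum as Sum
open import Data.Empty using (⊥; ⊥-elim)
open import Data.Vec using ([]; _∷_)
open import Function using (_∘_)
open import Relation.Nullary using (¬_; yes; no; contradiction)
open import Relation.Binary.PropositionalEquality using (_≡_; refl; sym; subst)
import Algebra.Properties.CommutativeSemigroup as CommutativeSemigroupProperties
import Relation.Binary.Reasoning.Setoid as SetoidReasoning

∣p∪q∣≤∣p∣+∣q∣ : ∀ {n} (p q : Subset n) → ∣ p ∪ q ∣ ≤ ∣ p ∣ + ∣ q ∣
∣p∪q∣≤∣p∣+∣q∣ []            []            = z≤n
∣p∪q∣≤∣p∣+∣q∣ (outside ∷ p) (outside ∷ q) = ∣p∪q∣≤∣p∣+∣q∣ p q
∣p∪q∣≤∣p∣+∣q∣ (outside ∷ p) (inside  ∷ q) =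
  ℕ.≤-trans (s≤s (∣p∪q∣≤∣p∣+∣q∣ p q)) (ℕ.≤-reflexive (sym (ℕ.+-suc ∣ p ∣ ∣ q ∣)))
∣p∪q∣≤∣p∣+∣q∣ (inside  ∷ p) (outside ∷ q) = s≤s (∣p∪q∣≤∣p∣+∣q∣ p q)
∣p∪q∣≤∣p∣+∣q∣ (inside  ∷ p) (inside  ∷ q) =
  s≤s (ℕ.≤-trans (∣p∪q∣≤∣p∣+∣q∣ p q) (ℕ.+-monoʳ-≤ ∣ p ∣ (ℕ.n≤1+n ∣ q ∣)))

p⊆q∪r⇒∣p∣≤∣q∣+∣r∣ : ∀ {n} {p q r : Subset n} → p ⊆ q ∪ r → ∣ p ∣ ≤ ∣ q ∣ + ∣ r ∣
p⊆q∪r⇒∣p∣≤∣q∣+∣r∣ {q = q} {r} p⊆q∪r = ℕ.≤-trans (p⊆q⇒∣p∣≤∣q∣ p⊆q∪r) (∣p∪q∣≤∣p∣+∣q∣ q r)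

p⊆q∪r⇒p∩q≡∅⇒p⊆r : ∀ {n} {p q r : Subset n} → p ⊆ q ∪ r → Empty (p ∩ q) → p ⊆ r
p⊆q∪r⇒p∩q≡∅⇒p⊆r {q = q} {r} p⊆q∪r p∩q≡∅ {x} x∈p with x∈p∪q⁻ q r (p⊆q∪r x∈p)
... | inj₁ x∈q = contradiction (x , x∈p∩q⁺ (x∈p , x∈q)) p∩q≡∅
... | inj₂ x∈r = x∈r

x∈p∩∁q⁺ : ∀ {n} {p q : Subset n} {x : Fin n} → x ∈ p → x ∉ q → x ∈ p ∩ ∁ q
x∈p∩∁q⁺ x∈p x∉q = x∈p∩q⁺ (x∈p , x∉p⇒x∈∁p x∉q)

x∈p∩∁q⇒x∉q : ∀ {n} (p {q} : Subset n) {x : Fin n} → x ∈ p ∩ ∁ q → x ∉ q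
x∈p∩∁q⇒x∉q p {q} = x∈∁p⇒x∉p ∘ proj₂ ∘ x∈p∩q⁻ p (∁ q)

p⊆q∪p∩∁q : ∀ {n} (p q : Subset n) → p ⊆ q ∪ (p ∩ ∁ q)
p⊆q∪p∩∁q p q {x} x∈p with x ∈? q
... | yes x∈q = x∈p∪q⁺ (inj₁ x∈q)
... | no  x∉q = x∈p∪q⁺ (inj₂ (x∈p∩∁q⁺ x∈p x∉q))

p⊆q∪r⇒p⊆p∩q∪p∩r : ∀ {n} {p q r : Subset n} → p ⊆ q ∪ r → p ⊆ (p ∩ q) ∪ (p ∩ r)
p⊆q∪r⇒p⊆p∩q∪p∩r {q = q} {r} p⊆q∪r x∈p =
  x∈p∪q⁺ (Sum.map (x∈p∩q⁺ ∘ (x∈p ,_)) (x∈p∩q⁺ ∘ (x∈p ,_)) (x∈p∪q⁻ q r (p⊆q∪r x∈p)))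

module _ {c ℓ : Level} (F : Field c ℓ) where
  open Field F using (Carrier; _≈_; _*_; 0#; 1#; inverse; setoid; *-comm;
                      *-congˡ; *-congʳ; zeroˡ; *-identityʳ; *-commutativeSemigroup)
    renaming (sym to ≈-sym; trans to ≈-trans)
  open CommutativeSemigroupProperties *-commutativeSemigroup using (interchange)

  _ᵀ : ∀ {n} → Matrix F n → Matrix F n
  (A ᵀ) i j = A j i

  RankAtMostOne-ᵀ : ∀ {n} {A : Matrix F n} {P Q : Subset n} →
    RankAtMostOne F A P Q → RankAtMostOne F (A ᵀ) Q P
  RankAtMostOne-ᵀ {n} {A} {P} {Q} (u , column) = coefficient , λ i i∈P → u i , row i i∈P
    where
    coefficient : Fin n → Carrier
    coefficient j with j ∈? Q
    ... | yes j∈Q = proj₁ (column j j∈Q)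
    ... | no  _   = 0#
    row : ∀ i → i ∈ P → ∀ j → j ∈ Q → A i j ≈ u i * coefficient j
    row i i∈P j j∈Q with j ∈? Q
    ... | yes j∈Q′ = ≈-trans (proj₂ (column j j∈Q′) i i∈P) (*-comm _ _)
    ... | no  j∉Q  = contradiction j∈Q j∉Q

  SpannedByColumn : ∀ {n} → Matrix F n → Subset n → Subset n → Fin n → Set (c ⊔ ℓ)
  SpannedByColumn A P Q t = ∀ j → j ∈ Q → ∃ λ b → ∀ i → i ∈ P → A i j ≈ b * A i t

  RankAtMostOne⇒SpannedByColumn : ∀ {n} {A : Matrix F n} {P Q : Subset n} {p t : Fin n} →
    RankAtMostOne F A P Q → t ∈ Q → p ∈ P → ¬ (A p t ≈ 0#) → SpannedByColumn A P Q t
  RankAtMostOne⇒SpannedByColumn {A = A} {p = p} {t} (u , column) t∈Q p∈P Apt≉0 j j∈Q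
    with column t t∈Q | column j j∈Q
  ... | aₜ , Aₜ≈ | aⱼ , Aⱼ≈ with inverse aₜ aₜ≉0
    where
    aₜ≉0 : ¬ (aₜ ≈ 0#)
    aₜ≉0 aₜ≈0 = Apt≉0 (≈-trans (Aₜ≈ _ p∈P) (≈-trans (*-congʳ aₜ≈0) (zeroˡ _)))
  ... | aₜ⁻¹ , aₜaₜ⁻¹≈1 = aⱼ * aₜ⁻¹ , λ i i∈P → begin
    A i j                      ≈⟨ Aⱼ≈ i i∈P ⟩
    aⱼ * u i                   ≈⟨ ≈-sym (*-identityʳ _) ⟩
    (aⱼ * u i) * 1#            ≈⟨ *-congˡ (≈-sym (≈-trans (*-comm aₜ⁻¹ aₜ) aₜaₜ⁻¹≈1)) ⟩
    (aⱼ * u i) * (aₜ⁻¹ * aₜ)   ≈⟨ interchange aⱼ (u i) aₜ⁻¹ aₜ ⟩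
    (aⱼ * aₜ⁻¹) * (u i * aₜ)   ≈⟨ *-congˡ (≈-trans (*-comm (u i) aₜ) (≈-sym (Aₜ≈ i i∈P))) ⟩
    (aⱼ * aₜ⁻¹) * A i t        ∎
    where
    open SetoidReasoning setoid

  Splits : ∀ {n} → Matrix F n → Subset n → Set (c ⊔ ℓ)
  Splits A P = RankAtMostOne F A P (⊤ ∩ ∁ P) × RankAtMostOne F A (⊤ ∩ ∁ P) P

  RankAtMostOne-glue : ∀ {n} {A : Matrix F n} {S U V P : Subset n} {p t : Fin n} →
    RankAtMostOne F A S (⊤ ∩ ∁ S) → RankAtMostOne F A U V →
    P ⊆ S → P ⊆ U → (∀ {j} → j ∈ S → j ∉ P → j ∈ V) →
    p ∈ P → t ∈ V → t ∉ S → ¬ (A p t ≈ 0#) →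
    RankAtMostOne F A P (⊤ ∩ ∁ P)
  RankAtMostOne-glue {A = A} {S} {P = P} {t = t} rankS rankUV P⊆S P⊆U S∖P⊆V p∈P t∈V t∉S Apt≉0 =
    (λ i → A i t) , column
    where
    restrict : ∀ {Q j} → P ⊆ Q → (∃ λ b → ∀ i → i ∈ Q → A i j ≈ b * A i t) →
               ∃ λ b → ∀ i → i ∈ P → A i j ≈ b * A i t
    restrict P⊆Q (b , eq) = b , λ i → eq i ∘ P⊆Q
    column : SpannedByColumn A P (⊤ ∩ ∁ P) t
    column j j∈∁P with j ∈? S
    ... | yes j∈S = restrict P⊆U
      (RankAtMostOne⇒SpannedByColumn rankUV t∈V (P⊆U p∈P) Apt≉0 j
        (S∖P⊆V j∈S (x∈p∩∁q⇒x∉q ⊤ j∈∁P)))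
    ... | no  j∉S = restrict P⊆S
      (RankAtMostOne⇒SpannedByColumn rankS (x∈p∩∁q⁺ ∈⊤ t∉S) (P⊆S p∈P) Apt≉0 j
        (x∈p∩∁q⁺ ∈⊤ j∉S))

  Splits-glue : ∀ {n} {A : Matrix F n} {S U V P : Subset n} {p t : Fin n} →
    Splits A S → RankAtMostOne F A U V → RankAtMostOne F A V U →
    P ⊆ S → P ⊆ U → (∀ {j} → j ∈ S → j ∉ P → j ∈ V) →
    p ∈ P → t ∈ V → t ∉ S → ¬ (A p t ≈ 0#) → ¬ (A t p ≈ 0#) → Splits A P
  Splits-glue (columnsS , rowsS) rankUV rankVU P⊆S P⊆U S∖P⊆V p∈P t∈V t∉S Apt≉0 Atp≉0 =
    RankAtMostOne-glue columnsS rankUV P⊆S P⊆U S∖P⊆V p∈P t∈V t∉S Apt≉0 ,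
    RankAtMostOne-ᵀ (RankAtMostOne-glue (RankAtMostOne-ᵀ rowsS) (RankAtMostOne-ᵀ rankVU)
                       P⊆S P⊆U S∖P⊆V p∈P t∈V t∉S Atp≉0)

  minimalCut-⊂-¬Splits : ∀ {n} {A : Matrix F n} {S P : Subset n} →
    IsMinimalCut F A S → P ⊂ S → 2 ≤ ∣ P ∣ → ¬ Splits A P
  minimalCut-⊂-¬Splits {n} {P = P}
    ((_ , _ , ∣S∣+2≤n , _) , minimal) (P⊆S , w , w∈S , w∉P) 2≤∣P∣ splitsP =
    w∉P (subst (w ∈_) (sym (minimal P ((λ _ → ∈⊤) , 2≤∣P∣ , ∣P∣+2≤n , splitsP) P⊆S)) w∈S)
    where
    ∣P∣+2≤n : ∣ P ∣ + 2 ≤ ∣ ⊤ {n} ∣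
    ∣P∣+2≤n = ℕ.≤-trans (ℕ.+-monoˡ-≤ 2 (p⊆q⇒∣p∣≤∣q∣ P⊆S)) ∣S∣+2≤n

  minimalCut-unsplittable : ∀ {n} {A : Matrix F n} {S U V : Subset n} {y z t : Fin n} →
    OffDiagNonzero F A → IsMinimalCut F A S →
    RankAtMostOne F A U V → RankAtMostOne F A V U → S ⊆ U ∪ V →
    2 ≤ ∣ S ∩ U ∣ → y ∈ S ∩ U → z ∈ S → z ∉ U → t ∈ V → t ∉ S → ⊥
  minimalCut-unsplittable {S = S} {U} {V} {y} {z} {t}
    offDiag minimal@((_ , _ , _ , splitsS) , _) rankUV rankVU S⊆U∪V 2≤∣S∩U∣ y∈S∩U z∈S z∉U t∈V t∉S =
    minimalCut-⊂-¬Splits minimal (p∩q⊆p S U , z , z∈S , z∉U ∘ p∩q⊆q S U) 2≤∣S∩U∣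
      (Splits-glue splitsS rankUV rankVU (p∩q⊆p S U) (p∩q⊆q S U) S∖U⊆V y∈S∩U t∈V t∉S
        (offDiag y t y≢t) (offDiag t y (y≢t ∘ sym)))
    where
    y≢t : ¬ (y ≡ t)
    y≢t y≡t = t∉S (subst (_∈ S) y≡t (p∩q⊆p S U y∈S∩U))
    S∖U⊆V : ∀ {j} → j ∈ S → j ∉ S ∩ U → j ∈ V
    S∖U⊆V {j} j∈S j∉S∩U with x∈p∪q⁻ U V (S⊆U∪V j∈S)
    ... | inj₁ j∈U = contradiction (x∈p∩q⁺ (j∈S , j∈U)) j∉S∩U
    ... | inj₂ j∈V = j∈V

  record RankOneBipartition {n} (A : Matrix F n) (I : Subset n) : Set (c ⊔ ℓ) where
    field
      U V      : Subset n
      U⊆I      : U ⊆ I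
      V⊆I      : V ⊆ I
      I⊆U∪V    : I ⊆ U ∪ V
      disjoint : ∀ {x} → x ∈ U → x ∉ V
      2≤∣U∣    : 2 ≤ ∣ U ∣
      2≤∣V∣    : 2 ≤ ∣ V ∣
      rankUV   : RankAtMostOne F A U V
      rankVU   : RankAtMostOne F A V U

  swap : ∀ {n} {A : Matrix F n} {I : Subset n} → RankOneBipartition A I → RankOneBipartition A I
  swap B = record
    { U = V ; V = U ; U⊆I = V⊆I ; V⊆I = U⊆I
    ; I⊆U∪V = x∈p∪q⁺ ∘ Sum.swap ∘ x∈p∪q⁻ U V ∘ I⊆U∪V
    ; disjoint = λ x∈V x∈U → disjoint x∈U x∈V
    ; 2≤∣U∣ = 2≤∣V∣ ; 2≤∣V∣ = 2≤∣U∣ ; rankUV = rankVU ; rankVU = rankUV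
    }
    where open RankOneBipartition B

  IsCutOf⇒RankOneBipartition : ∀ {n} {A : Matrix F n} {I X : Subset n} →
    IsCutOf F A I X → RankOneBipartition A I
  IsCutOf⇒RankOneBipartition {I = I} {X} (X⊆I , 2≤∣X∣ , ∣X∣+2≤∣I∣ , rankUV , rankVU) = record
    { U = X ; V = I ∩ ∁ X ; U⊆I = X⊆I ; V⊆I = p∩q⊆p I (∁ X)
    ; I⊆U∪V = p⊆q∪p∩∁q I X
    ; disjoint = λ x∈X → contradiction x∈X ∘ x∈p∩∁q⇒x∉q I
    ; 2≤∣U∣ = 2≤∣X∣
    ; 2≤∣V∣ = ℕ.+-cancelˡ-≤ ∣ X ∣ 2 _ (ℕ.≤-trans ∣X∣+2≤∣I∣ (p⊆q∪r⇒∣p∣≤∣q∣+∣r∣ (p⊆q∪p∩∁q I X)))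
    ; rankUV = rankUV ; rankVU = rankVU
    }

  open RankOneBipartition

  S⊆V⇒U⊆T : ∀ {n} {A : Matrix F n} {S T : Subset n} (B : RankOneBipartition A (S ∪ T)) →
    S ⊆ V B → U B ⊆ T
  S⊆V⇒U⊆T {S = S} {T} B S⊆V x∈U with x∈p∪q⁻ S T (U⊆I B x∈U)
  ... | inj₁ x∈S = contradiction (S⊆V x∈S) (disjoint B x∈U)
  ... | inj₂ x∈T = x∈T

  ¬S⊆V[S∪⁅t⁆] : ∀ {n} {A : Matrix F n} {S : Subset n} {t : Fin n}
    (B : RankOneBipartition A (S ∪ ⁅ t ⁆)) → ¬ (S ⊆ V B)
  ¬S⊆V[S∪⁅t⁆] {t = t} B S⊆V = ℕ.<-irrefl refl
    (subst (2 ≤_) (∣⁅x⁆∣≡1 t) (ℕ.≤-trans (2≤∣U∣ B) (p⊆q⇒∣p∣≤∣q∣ (S⊆V⇒U⊆T B S⊆V))))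

  module _ {n} {A : Matrix F n} {S T : Subset n} (offDiag : OffDiagNonzero F A)
           (minimal : IsMinimalCut F A S) (T≢∅ : Nonempty T) (T⊆∁S : T ⊆ ∁ S) where

    S⊆U∪V : (B : RankOneBipartition A (S ∪ T)) → S ⊆ U B ∪ V B
    S⊆U∪V B = I⊆U∪V B ∘ p⊆p∪q T

    minimalCut-¬straddles : (B : RankOneBipartition A (S ∪ T)) {y z : Fin n} →
      2 ≤ ∣ S ∩ U B ∣ → y ∈ S ∩ U B → z ∈ S ∩ V B → ⊥
    minimalCut-¬straddles B 2≤∣S∩U∣ y∈S∩U z∈S∩V with nonempty? (T ∩ V B)
    ... | yes (t , t∈T∩V) =
      minimalCut-unsplittable offDiag minimal (rankUV B) (rankVU B) (S⊆U∪V B) 2≤∣S∩U∣ y∈S∩U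
        (p∩q⊆p S (V B) z∈S∩V) (λ z∈U → disjoint B z∈U (p∩q⊆q S (V B) z∈S∩V))
        (p∩q⊆q T (V B) t∈T∩V) (x∈∁p⇒x∉p (T⊆∁S (p∩q⊆p T (V B) t∈T∩V)))
    ... | no T∩V≡∅ =
      minimalCut-unsplittable offDiag minimal (rankVU B) (rankUV B) (S⊆U∪V (swap B))
        (ℕ.≤-trans (2≤∣V∣ B) (p⊆q⇒∣p∣≤∣q∣ V⊆S∩V)) z∈S∩V
        (p∩q⊆p S (U B) y∈S∩U) (disjoint B (p∩q⊆q S (U B) y∈S∩U))
        t₀∈U (x∈∁p⇒x∉p (T⊆∁S t₀∈T))
      where
      t₀ : Fin n
      t₀ = proj₁ T≢∅
      t₀∈T : t₀ ∈ T
      t₀∈T = proj₂ T≢∅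
      V⊆S∩V : V B ⊆ S ∩ V B
      V⊆S∩V {x} x∈V with x∈p∪q⁻ S T (V⊆I B x∈V)
      ... | inj₁ x∈S = x∈p∩q⁺ (x∈S , x∈V)
      ... | inj₂ x∈T = contradiction (x , x∈p∩q⁺ (x∈T , x∈V)) T∩V≡∅
      t₀∈U : t₀ ∈ U B
      t₀∈U with x∈p∪q⁻ (U B) (V B) (I⊆U∪V B (q⊆p∪q S T t₀∈T))
      ... | inj₁ t₀∈U = t₀∈U
      ... | inj₂ t₀∈V = contradiction (t₀ , x∈p∩q⁺ (t₀∈T , t₀∈V)) T∩V≡∅

    minimalCut-onOneSide : 2 < ∣ S ∣ → (B : RankOneBipartition A (S ∪ T)) → S ⊆ U B ⊎ S ⊆ V B
    minimalCut-onOneSide 2<∣S∣ B with nonempty? (S ∩ U B) | nonempty? (S ∩ V B)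
    ... | no S∩U≡∅ | _         = inj₂ (p⊆q∪r⇒p∩q≡∅⇒p⊆r (S⊆U∪V B) S∩U≡∅)
    ... | yes _    | no S∩V≡∅  = inj₁ (p⊆q∪r⇒p∩q≡∅⇒p⊆r (S⊆U∪V (swap B)) S∩V≡∅)
    ... | yes (y , y∈S∩U) | yes (z , z∈S∩V) with 2 ≤? ∣ S ∩ U B ∣
    ...   | yes 2≤∣S∩U∣ = ⊥-elim (minimalCut-¬straddles B 2≤∣S∩U∣ y∈S∩U z∈S∩V)
    ...   | no  2≰∣S∩U∣ = ⊥-elim (minimalCut-¬straddles (swap B) 2≤∣S∩V∣ z∈S∩V y∈S∩U)
      where
      2≤∣S∩V∣ : 2 ≤ ∣ S ∩ V B ∣
      2≤∣S∩V∣ = ℕ.+-cancelˡ-≤ 1 2 _ (ℕ.≤-trans 2<∣S∣ (ℕ.≤-trans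
        (p⊆q∪r⇒∣p∣≤∣q∣+∣r∣ (p⊆q∪r⇒p⊆p∩q∪p∩r (S⊆U∪V B)))
        (ℕ.+-monoˡ-≤ _ (ℕ.≤-pred (ℕ.≰⇒> 2≰∣S∩U∣)))))

lemma11 : ∀ {c ℓ : Level} (F : Field c ℓ) (n : ℕ) (A : Matrix F n) →
    OffDiagNonzero F A →
    (S : Subset n) → IsMinimalCut F A S → 2 < ∣ S ∣ →
    ((T : Subset n) → Nonempty T → T ⊆ ∁ S →
       (X : Subset n) → X ⊆ (S ∪ T) →
       IsCutOf F A (S ∪ T) X →
       (S ⊆ X) ⊎ (S ⊆ ((S ∪ T) ∩ ∁ X)))
    ×
    ((t : Fin n) → t ∉ S → (X : Subset n) → ¬ IsCutOf F A (S ∪ ⁅ t ⁆) X)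
lemma11 F n A offDiag S minimal 2<∣S∣ = onOneSide , noCut
  where
  onOneSide : (T : Subset n) → Nonempty T → T ⊆ ∁ S → (X : Subset n) → X ⊆ (S ∪ T) →
    IsCutOf F A (S ∪ T) X → (S ⊆ X) ⊎ (S ⊆ ((S ∪ T) ∩ ∁ X))
  onOneSide T T≢∅ T⊆∁S _ _ cut =
    minimalCut-onOneSide F offDiag minimal T≢∅ T⊆∁S 2<∣S∣ (IsCutOf⇒RankOneBipartition F cut)
  noCut : (t : Fin n) → t ∉ S → (X : Subset n) → ¬ IsCutOf F A (S ∪ ⁅ t ⁆) X
  noCut t t∉S X cut with onOneSide ⁅ t ⁆ (t , x∈⁅x⁆ t) ⁅t⁆⊆∁S X (proj₁ cut) cut
    where
    ⁅t⁆⊆∁S : ⁅ t ⁆ ⊆ ∁ S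
    ⁅t⁆⊆∁S x∈⁅t⁆ = x∉p⇒x∈∁p (t∉S ∘ subst (_∈ S) (x∈⁅y⁆⇒x≡y t x∈⁅t⁆))
  ... | inj₁ S⊆X  = ¬S⊆V[S∪⁅t⁆] F (swap F (IsCutOf⇒RankOneBipartition F cut)) S⊆X
  ... | inj₂ S⊆X̃ = ¬S⊆V[S∪⁅t⁆] F (IsCutOf⇒RankOneBipartition F cut) S⊆X̃
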